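{- Let $G$ be a complete multipartite graph having exactly $n\ge 1$ parts of odd cardinality, and suppose $n=j^{2}+\delta$ for a positive integer $j$ and some $\delta\in\{ -2,0,2\}$. Then the cordial vertex deficiency satisfies $\mathrm{cvd}(G)\le j-1$.
   Context: Graphs are finite and may have multiple edges but no loops. A binary labeling of a graph $G$ is a map $f:V(G)\to\{0,1\}$, inducing an edge labeling $f_e(uv)=f(u)+f(v)\pmod 2$. Two real numbers $x,y$ are roughly equal if $|x-y|\le 1$. A binary labeling $f$ is friendly if $|f^{ -1}(0)|$ and $|f^{ -1}(1)|$ are roughly equal, and cordial if it is friendly and $|f_e^{ -1}(0)|$ and $|f_e^{ -1}(1)|$ are roughly equal. The cordial vertex deficiency $\mathrm{cvd}(G)$ is the minimum, taken over all binary labelings $f$ of $G$ for which $|f_e^{ -1}(0)|$ and $|f_e^{ -1}(1)|$ are roughly equal, of the number of labeled isolated vertices that must be added to $G$ so that (the extension of) $f$ becomes a friendly (hence cordial) labeling of the augmented graph; if no such binary labeling exists, $\mathrm{cvd}(G)=\infty$. A complete multipartite graph is a graph whose vertex set is partitioned into nonempty parts, with two vertices adjacent (by a single edge) if and only if they lie in different parts. -}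

module Defs where

open import Data.Nat using (ℕ; zero; suc; _+_; _*_; _<_; _≤_; ∣_-_∣)
open import Data.Nat.Base using (_<ᵇ_)
open import Data.Bool using (Bool; true; false; if_then_else_; _xor_)
open import Data.Fin using (Fin; toℕ)
import Data.Fin as F
open import Data.Product using (Σ; _×_; ∃)
open import Relation.Binary.PropositionalEquality using (_≡_)

∑ : (n : ℕ) → (Fin n → ℕ) → ℕ
∑ zero    g = 0
∑ (suc n) g = g F.zero + ∑ n (λ i → g (F.suc i))

[_] : Bool → ℕ
[ true ]  = 1
[ false ] = 0

not' : Bool → Bool
not' true = false
not' false = true

-- Binary labels: false = 0, true = 1.
-- A complete multipartite graph with m parts is given by its part sizes
-- size : Fin m → ℕ (all nonzero); its vertices are pairs (i , x) with
-- i : Fin m, x : Fin (size i); two vertices are joined by a single edge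
-- iff they lie in different parts.
Labeling : (m : ℕ) → (Fin m → ℕ) → Set
Labeling m size = (i : Fin m) → Fin (size i) → Bool

vcount : (m : ℕ) (size : Fin m → ℕ) → Labeling m size → Bool → ℕ
vcount m size f b = ∑ m (λ i → ∑ (size i) (λ x → [ if f i x xor b then false else true ]))

-- number of edges with induced label b (edge label = f u + f v mod 2),
-- each edge {(i,x),(k,y)} with i < k counted once.
ecount : (m : ℕ) (size : Fin m → ℕ) → Labeling m size → Bool → ℕ
ecount m size f b =
  ∑ m (λ i → ∑ m (λ k →
    if toℕ i <ᵇ toℕ k
    then ∑ (size i) (λ x → ∑ (size k) (λ y →
           [ if (f i x xor f k y) xor b then false else true ]))
    else 0))

RoughlyEqual : ℕ → ℕ → Set
RoughlyEqual x y = ∣ x - y ∣ ≤ 1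

isOdd : ℕ → Bool
isOdd zero = false
isOdd (suc n) = not' (isOdd n)

oddParts : (m : ℕ) → (Fin m → ℕ) → ℕ
oddParts m size = ∑ m (λ i → [ isOdd (size i) ])

-- f is edge-balanced and adding a isolated vertices labeled 0 and
-- b isolated vertices labeled 1 (a + b = k) makes f friendly.
FixableWith : (m : ℕ) (size : Fin m → ℕ) → Labeling m size → ℕ → Set
FixableWith m size f k =
  RoughlyEqual (ecount m size f false) (ecount m size f true) ×
  Σ ℕ (λ a → Σ ℕ (λ b → (a + b ≡ k) ×
    RoughlyEqual (vcount m size f false + a) (vcount m size f true + b)))

-- cvd(G) ≤ c : some edge-balanced labeling needs at most c added
-- isolated labeled vertices to become friendly (cordial).
CvdAtMost : (m : ℕ) (size : Fin m → ℕ) → ℕ → Set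
CvdAtMost m size c = Σ (Labeling m size) (λ f → Σ ℕ (λ k → (k ≤ c) × FixableWith m size f k))

-- Give every odd part one more vertex of one label than of the other and
-- every even part equally many of each, so that the part balances
-- d_i = #0 − #1 lie in {0, ±1} with d_i = ±1 exactly on the n odd parts.
-- The vertex balance is Σ d_i and the edge balance (#0 − #1 edges) is
-- e₂(d) = Σ_{i<k} d_i d_k, because an edge between two parts gets label 0
-- iff its ends agree.  Since 2 e₂(d) = (Σ d_i)² − Σ d_i² = (Σ d_i)² − n,
-- making j + q odd parts positive and q negative, where n = 2q + j (as
-- j² − j is even), gives vertex balance j and edge balance −δ/2 ∈ {−1, 0, 1};
-- the vertex imbalance is then repaired by j − 1 isolated vertices labelled 1.
module Submission where

open import Defs
open import Data.Nat using (ℕ; _≤_; _∸_)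
open import Data.Fin using (Fin)
open import Data.Integer using (ℤ; +_; -_; _*_; _+_)
open import Data.Sum using (_⊎_)
open import Relation.Binary.PropositionalEquality using (_≡_)

open import Data.Integer using (_-_; _⊖_; ∣_∣)
import Data.Nat as ℕ
import Data.Nat.Properties as ℕₚ
import Data.Integer.Properties as ℤₚ
open import Data.Bool using (Bool; true; false; if_then_else_; _xor_)
open import Data.Fin using (zero; suc; toℕ)
open import Data.Vec.Functional using (Vector; _∷_)
open import Data.Product using (_,_; ∃-syntax; Σ-syntax)
open import Data.Sum using (inj₁; inj₂)
open import Function using (_∘_)
open import Relation.Binary.PropositionalEquality
  using (refl; sym; trans; cong; cong₂; module ≡-Reasoning)
open import Algebra.Properties.Semiring.Sum ℤₚ.+-*-semiring
  using (sum; sum-syntax; sum-cong-≗; ∑-distrib-+; *-distribˡ-sum; *-distribʳ-sum)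
import Data.Integer.Tactic.RingSolver as ℤ-Solver
import Data.Nat.Tactic.RingSolver as ℕ-Solver

open ≡-Reasoning

∑-neg : ∀ {m} (f : Vector ℤ m) → sum (λ i → - f i) ≡ - sum f
∑-neg {ℕ.zero}  f = refl
∑-neg {ℕ.suc m} f =
  trans (cong (_+_ (- f zero)) (∑-neg (f ∘ suc))) (sym (ℤₚ.neg-distrib-+ (f zero) _))

∑-distrib-- : ∀ {m} (f g : Vector ℤ m) → sum (λ i → f i - g i) ≡ sum f - sum g
∑-distrib-- f g = trans (∑-distrib-+ f (λ i → - g i)) (cong (_+_ (sum f)) (∑-neg g))

∑-*-∑ : ∀ {s t} (u : Vector ℤ s) (v : Vector ℤ t) →
  sum (λ x → sum (λ y → u x * v y)) ≡ sum u * sum v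
∑-*-∑ u v = begin
  sum (λ x → sum (λ y → u x * v y))  ≡⟨ sum-cong-≗ (λ x → sym (*-distribˡ-sum (u x) v)) ⟩
  sum (λ x → u x * sum v)            ≡⟨ sym (*-distribʳ-sum (sum v) u) ⟩
  sum u * sum v                      ∎

pos-∑ : ∀ m (g : Fin m → ℕ) → + ∑ m g ≡ ∑[ i < m ] (+ g i)
pos-∑ ℕ.zero    g = refl
pos-∑ (ℕ.suc m) g = trans (ℤₚ.pos-+ (g zero) _) (cong (_+_ (+ g zero)) (pos-∑ m (g ∘ suc)))

pos-∑-∑ : ∀ m (g h : Fin m → ℕ) → + ∑ m g - + ∑ m h ≡ ∑[ i < m ] (+ g i - + h i)
pos-∑-∑ m g h = trans (cong₂ _-_ (pos-∑ m g) (pos-∑ m h)) (sym (∑-distrib-- (λ i → + g i) (λ i → + h i)))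

spin : Bool → ℤ
spin false = + 1
spin true  = - + 1

spin-xor : ∀ a b → spin (a xor b) ≡ spin a * spin b
spin-xor false false = refl
spin-xor false true  = refl
spin-xor true  false = refl
spin-xor true  true  = refl

spin-not' : ∀ b → spin (not' b) ≡ - spin b
spin-not' false = refl
spin-not' true  = refl

indicator-balance : ∀ v →
  + [ if v xor false then false else true ] - + [ if v xor true then false else true ] ≡ spin v
indicator-balance false = refl
indicator-balance true  = refl

balance : ∀ {m size} → Labeling m size → Fin m → ℤ
balance {size = size} f i = ∑[ x < size i ] spin (f i x)

vcount-balance : ∀ m size (f : Labeling m size) →
  + vcount m size f false - + vcount m size f true ≡ sum (balance f)
vcount-balance m size f = trans (pos-∑-∑ m _ _) (sum-cong-≗ λ i →
  trans (pos-∑-∑ (size i) _ _) (sum-cong-≗ λ x → indicator-balance (f i x)))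

pairSum : ∀ {m} → Vector ℤ m → ℤ
pairSum {m} d = ∑[ i < m ] ∑[ k < m ] (if toℕ i ℕ.<ᵇ toℕ k then d i * d k else + 0)

cross-balance : ∀ s t (u : Fin s → Bool) (v : Fin t → Bool) →
  + ∑ s (λ x → ∑ t (λ y → [ if (u x xor v y) xor false then false else true ]))
  - + ∑ s (λ x → ∑ t (λ y → [ if (u x xor v y) xor true then false else true ]))
  ≡ ∑[ x < s ] spin (u x) * ∑[ y < t ] spin (v y)
cross-balance s t u v = begin
  _                                                       ≡⟨ pos-∑-∑ s _ _ ⟩
  ∑[ x < s ] (+ ∑ t (indicator x false) - + ∑ t (indicator x true))
    ≡⟨ sum-cong-≗ (λ x → pos-∑-∑ t (indicator x false) (indicator x true)) ⟩
  ∑[ x < s ] ∑[ y < t ] (+ indicator x false y - + indicator x true y)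
    ≡⟨ sum-cong-≗ (λ x → sum-cong-≗ λ y → indicator-balance (u x xor v y)) ⟩
  ∑[ x < s ] ∑[ y < t ] spin (u x xor v y)
    ≡⟨ sum-cong-≗ (λ x → sum-cong-≗ λ y → spin-xor (u x) (v y)) ⟩
  ∑[ x < s ] ∑[ y < t ] (spin (u x) * spin (v y))         ≡⟨ ∑-*-∑ (spin ∘ u) (spin ∘ v) ⟩
  ∑[ x < s ] spin (u x) * ∑[ y < t ] spin (v y)           ∎
  where
  indicator : Fin s → Bool → Fin t → ℕ
  indicator x b y = [ if (u x xor v y) xor b then false else true ]

if-balance : ∀ c {x y z} → + x - + y ≡ z →
  + (if c then x else 0) - + (if c then y else 0) ≡ (if c then z else + 0)
if-balance true  eq = eq
if-balance false eq = refl

ecount-balance : ∀ m size (f : Labeling m size) →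
  + ecount m size f false - + ecount m size f true ≡ pairSum (balance f)
ecount-balance m size f = trans (pos-∑-∑ m _ _) (sum-cong-≗ λ i →
  trans (pos-∑-∑ m _ _) (sum-cong-≗ λ k →
    if-balance (toℕ i ℕ.<ᵇ toℕ k) (cross-balance (size i) (size k) (f i) (f k))))

pairSum-suc : ∀ {m} (d : Vector ℤ (ℕ.suc m)) →
  pairSum d ≡ d zero * sum (d ∘ suc) + pairSum (d ∘ suc)
pairSum-suc {m} d = cong₂ _+_
  (trans (ℤₚ.+-identityˡ _) (sym (*-distribˡ-sum (d zero) (d ∘ suc))))
  (sum-cong-≗ {m} λ i → ℤₚ.+-identityˡ _)

pairSum-square : ∀ {m} (d : Vector ℤ m) →
  + 2 * pairSum d + ∑[ i < m ] (d i * d i) ≡ sum d * sum d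
pairSum-square {ℕ.zero}  d = refl
pairSum-square {ℕ.suc m} d = begin
  + 2 * pairSum d + (a * a + T)            ≡⟨ cong (λ P → + 2 * P + (a * a + T)) (pairSum-suc d) ⟩
  + 2 * (a * S + P) + (a * a + T)          ≡⟨ regroup a S P T ⟩
  + 2 * a * S + a * a + (+ 2 * P + T)      ≡⟨ cong (_+_ (+ 2 * a * S + a * a)) (pairSum-square (d ∘ suc)) ⟩
  + 2 * a * S + a * a + S * S              ≡⟨ binomial a S ⟩
  (a + S) * (a + S)                        ∎
  where
  a = d zero
  S = sum (d ∘ suc)
  P = pairSum (d ∘ suc)
  T = ∑[ i < m ] (d (suc i) * d (suc i))
  regroup : ∀ a S P T → + 2 * (a * S + P) + (a * a + T) ≡ + 2 * a * S + a * a + (+ 2 * P + T)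
  regroup = ℤ-Solver.solve-∀
  binomial : ∀ a S → + 2 * a * S + a * a + S * S ≡ (a + S) * (a + S)
  binomial = ℤ-Solver.solve-∀

2*pairSum≡-δ : ∀ {m} (d : Vector ℤ m) J N δ → sum d ≡ J → ∑[ i < m ] (d i * d i) ≡ N →
  N ≡ J * J + δ → + 2 * pairSum d ≡ - δ
2*pairSum≡-δ {m} d J N δ Σd≡J Σd²≡N N≡J²+δ = begin
  + 2 * pairSum d                  ≡⟨ add-sub (+ 2 * pairSum d) (∑[ i < m ] (d i * d i)) ⟩
  + 2 * pairSum d + ∑[ i < m ] (d i * d i) - ∑[ i < m ] (d i * d i)
                                   ≡⟨ cong₂ _-_ (pairSum-square d) (trans Σd²≡N N≡J²+δ) ⟩
  sum d * sum d - (J * J + δ)      ≡⟨ cong (λ s → s * s - (J * J + δ)) Σd≡J ⟩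
  J * J - (J * J + δ)              ≡⟨ cancel (J * J) δ ⟩
  - δ                              ∎
  where
  add-sub : ∀ x y → x ≡ x + y - y
  add-sub = ℤ-Solver.solve-∀
  cancel : ∀ x δ → x - (x + δ) ≡ - δ
  cancel = ℤ-Solver.solve-∀

one-minus-indicator : ∀ b → + 1 - + [ b ] ≡ + [ not' b ]
one-minus-indicator false = refl
one-minus-indicator true  = refl

alternating-balance : ∀ s → ∑[ x < s ] spin (isOdd (toℕ x)) ≡ + [ isOdd s ]
alternating-balance ℕ.zero    = refl
alternating-balance (ℕ.suc s) = begin
  + 1 + ∑[ x < s ] spin (not' (isOdd (toℕ x)))  ≡⟨ cong (_+_ (+ 1)) (sum-cong-≗ {s} λ x → spin-not' (isOdd (toℕ x))) ⟩
  + 1 + ∑[ x < s ] (- spin (isOdd (toℕ x)))     ≡⟨ cong (_+_ (+ 1)) (∑-neg {s} (spin ∘ isOdd ∘ toℕ)) ⟩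
  + 1 - ∑[ x < s ] spin (isOdd (toℕ x))         ≡⟨ cong (_-_ (+ 1)) (alternating-balance s) ⟩
  + 1 - + [ isOdd s ]                           ≡⟨ one-minus-indicator (isOdd s) ⟩
  + [ not' (isOdd s) ]                          ∎

twisted-alternating-balance : ∀ s b →
  ∑[ x < s ] spin (b xor isOdd (toℕ x)) ≡ spin b * + [ isOdd s ]
twisted-alternating-balance s b = begin
  ∑[ x < s ] spin (b xor isOdd (toℕ x))          ≡⟨ sum-cong-≗ {s} (λ x → spin-xor b (isOdd (toℕ x))) ⟩
  ∑[ x < s ] (spin b * spin (isOdd (toℕ x)))     ≡⟨ sym (*-distribˡ-sum {s} (spin b) (spin ∘ isOdd ∘ toℕ)) ⟩
  spin b * ∑[ x < s ] spin (isOdd (toℕ x))       ≡⟨ cong (_*_ (spin b)) (alternating-balance s) ⟩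
  spin b * + [ isOdd s ]                         ∎

spin-indicator-square : ∀ b o → (spin b * + [ o ]) * (spin b * + [ o ]) ≡ + [ o ]
spin-indicator-square false false = refl
spin-indicator-square false true  = refl
spin-indicator-square true  false = refl
spin-indicator-square true  true  = refl

alternating : ∀ {m size} → (Fin m → Bool) → Labeling m size
alternating σ i x = σ i xor isOdd (toℕ x)

alternating-balance-sum : ∀ m size (σ : Fin m → Bool) →
  sum (balance (alternating {m} {size} σ)) ≡ ∑[ i < m ] (spin (σ i) * + [ isOdd (size i) ])
alternating-balance-sum m size σ = sum-cong-≗ {m} λ i → twisted-alternating-balance (size i) (σ i)

alternating-square-sum : ∀ m size (σ : Fin m → Bool) →
  ∑[ i < m ] (balance (alternating {m} {size} σ) i * balance (alternating {m} {size} σ) i) ≡ + oddParts m size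
alternating-square-sum m size σ = trans (sum-cong-≗ {m} λ i →
    trans (cong₂ _*_ (balance≡ i) (balance≡ i)) (spin-indicator-square (σ i) (isOdd (size i))))
  (sym (pos-∑ m _))
  where
  balance≡ : ∀ i → balance (alternating {m} {size} σ) i ≡ spin (σ i) * + [ isOdd (size i) ]
  balance≡ i = twisted-alternating-balance (size i) (σ i)

signs-with-sum : ∀ m (o : Fin m → Bool) p q → p ℕ.+ q ≡ ∑ m (λ i → [ o i ]) →
  Σ[ σ ∈ (Fin m → Bool) ] ∑[ i < m ] (spin (σ i) * + [ o i ]) ≡ + p - + q
signs-with-sum ℕ.zero o ℕ.zero ℕ.zero refl = (λ ()) , refl
signs-with-sum (ℕ.suc m) o p q eq with o zero
... | false with signs-with-sum m (o ∘ suc) p q eq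
...   | σ , sum≡ = false ∷ σ , trans (ℤₚ.+-identityˡ _) sum≡
signs-with-sum (ℕ.suc m) o (ℕ.suc p) q eq | true with signs-with-sum m (o ∘ suc) p q (ℕₚ.suc-injective eq)
...   | σ , sum≡ = false ∷ σ , trans (cong (_+_ (+ 1)) sum≡) (one-plus (+ p) (+ q))
  where
  one-plus : ∀ p q → + 1 + (p - q) ≡ (+ 1 + p) - q
  one-plus = ℤ-Solver.solve-∀
signs-with-sum (ℕ.suc m) o ℕ.zero (ℕ.suc q) eq | true with signs-with-sum m (o ∘ suc) 0 q (ℕₚ.suc-injective eq)
...   | σ , sum≡ = true ∷ σ , trans (cong (_+_ (- + 1)) sum≡) (minus-one (+ q))
  where
  minus-one : ∀ q → - + 1 + (+ 0 - q) ≡ + 0 - (+ 1 + q)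
  minus-one = ℤ-Solver.solve-∀

+[q+j]-+q≡+j : ∀ q j → + (q ℕ.+ j) - + q ≡ + j
+[q+j]-+q≡+j q j = trans (cong (_- + q) (ℤₚ.pos-+ q j)) (cancel (+ q) (+ j))
  where
  cancel : ∀ q j → q + j - q ≡ j
  cancel = ℤ-Solver.solve-∀

square-suc : ∀ k → ℕ.suc k ℕ.* ℕ.suc k ≡ k ℕ.* k ℕ.+ k ℕ.+ ℕ.suc k
square-suc = ℕ-Solver.solve-∀

∃[t]t+n+t≡n*n : ∀ n → ∃[ t ] t ℕ.+ n ℕ.+ t ≡ n ℕ.* n
∃[t]t+n+t≡n*n ℕ.zero = 0 , refl
∃[t]t+n+t≡n*n (ℕ.suc n) with ∃[t]t+n+t≡n*n n
... | t , t+n+t≡n² = t ℕ.+ n , (begin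
  t ℕ.+ n ℕ.+ ℕ.suc n ℕ.+ (t ℕ.+ n)  ≡⟨ regroup t n ⟩
  t ℕ.+ n ℕ.+ t ℕ.+ n ℕ.+ ℕ.suc n    ≡⟨ cong (λ x → x ℕ.+ n ℕ.+ ℕ.suc n) t+n+t≡n² ⟩
  n ℕ.* n ℕ.+ n ℕ.+ ℕ.suc n          ≡⟨ sym (square-suc n) ⟩
  ℕ.suc n ℕ.* ℕ.suc n                ∎)
  where
  regroup : ∀ t n → t ℕ.+ n ℕ.+ ℕ.suc n ℕ.+ (t ℕ.+ n) ≡ t ℕ.+ n ℕ.+ t ℕ.+ n ℕ.+ ℕ.suc n
  regroup = ℕ-Solver.solve-∀

n≡j²+δ⇒∃[q]q+j+q≡n : ∀ n j δ → (δ ≡ - (+ 2) ⊎ δ ≡ + 0 ⊎ δ ≡ + 2) →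
  + n ≡ (+ j) * (+ j) + δ → ∃[ q ] q ℕ.+ j ℕ.+ q ≡ n
n≡j²+δ⇒∃[q]q+j+q≡n n j _ (inj₂ (inj₁ refl)) n≡j²+δ with ∃[t]t+n+t≡n*n j
... | t , t+j+t≡j² = t , (begin
  t ℕ.+ j ℕ.+ t  ≡⟨ t+j+t≡j² ⟩
  j ℕ.* j        ≡⟨ ℤₚ.+-injective (trans (ℤₚ.pos-* j j) (trans (sym (ℤₚ.+-identityʳ _)) (sym n≡j²+δ))) ⟩
  n              ∎)
n≡j²+δ⇒∃[q]q+j+q≡n n j _ (inj₂ (inj₂ refl)) n≡j²+δ with ∃[t]t+n+t≡n*n j
... | t , t+j+t≡j² = ℕ.suc t , (begin
  ℕ.suc t ℕ.+ j ℕ.+ ℕ.suc t  ≡⟨ regroup t j ⟩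
  t ℕ.+ j ℕ.+ t ℕ.+ 2        ≡⟨ cong (ℕ._+ 2) t+j+t≡j² ⟩
  j ℕ.* j ℕ.+ 2              ≡⟨ ℤₚ.+-injective (trans (cong (_+ + 2) (ℤₚ.pos-* j j)) (sym n≡j²+δ)) ⟩
  n                          ∎)
  where
  regroup : ∀ t j → ℕ.suc t ℕ.+ j ℕ.+ ℕ.suc t ≡ t ℕ.+ j ℕ.+ t ℕ.+ 2
  regroup = ℕ-Solver.solve-∀
n≡j²+δ⇒∃[q]q+j+q≡n n ℕ.zero           _ (inj₁ refl) ()
n≡j²+δ⇒∃[q]q+j+q≡n n (ℕ.suc ℕ.zero)   _ (inj₁ refl) ()
n≡j²+δ⇒∃[q]q+j+q≡n n (ℕ.suc (ℕ.suc i)) _ (inj₁ refl) n≡j²+δ with ∃[t]t+n+t≡n*n (ℕ.suc i)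
... | t , t+j+t≡j² = t ℕ.+ i , ℕₚ.+-cancelˡ-≡ 2 _ n (begin
  2 ℕ.+ (t ℕ.+ i ℕ.+ j ℕ.+ (t ℕ.+ i))                  ≡⟨ regroup t i ⟩
  t ℕ.+ ℕ.suc i ℕ.+ t ℕ.+ ℕ.suc i ℕ.+ j                ≡⟨ cong (λ x → x ℕ.+ ℕ.suc i ℕ.+ j) t+j+t≡j² ⟩
  ℕ.suc i ℕ.* ℕ.suc i ℕ.+ ℕ.suc i ℕ.+ j                ≡⟨ sym (square-suc (ℕ.suc i)) ⟩
  j ℕ.* j                                              ≡⟨ ℤₚ.+-injective (sym (trans (cong (_+_ (+ 2)) n≡j²+δ) (add-back _))) ⟩
  2 ℕ.+ n                                              ∎)
  where
  j = ℕ.suc (ℕ.suc i)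
  regroup : ∀ t i → 2 ℕ.+ (t ℕ.+ i ℕ.+ ℕ.suc (ℕ.suc i) ℕ.+ (t ℕ.+ i))
                  ≡ t ℕ.+ ℕ.suc i ℕ.+ t ℕ.+ ℕ.suc i ℕ.+ ℕ.suc (ℕ.suc i)
  regroup = ℕ-Solver.solve-∀
  add-back : ∀ x → + 2 + (x + - (+ 2)) ≡ x
  add-back = ℤ-Solver.solve-∀

∣-∣≡∣⊖∣ : ∀ a b → ℕ.∣ a - b ∣ ≡ ∣ a ⊖ b ∣
∣-∣≡∣⊖∣ ℕ.zero    ℕ.zero    = refl
∣-∣≡∣⊖∣ ℕ.zero    (ℕ.suc b) = refl
∣-∣≡∣⊖∣ (ℕ.suc a) ℕ.zero    = refl
∣-∣≡∣⊖∣ (ℕ.suc a) (ℕ.suc b) = trans (∣-∣≡∣⊖∣ a b) (cong ∣_∣ (sym (ℤₚ.[1+m]⊖[1+n]≡m⊖n a b)))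

roughlyEqual-from-ℤ : ∀ a b → ∣ + a - + b ∣ ≤ 1 → RoughlyEqual a b
roughlyEqual-from-ℤ a b ∣a-b∣≤1 =
  ℕₚ.≤-trans (ℕₚ.≤-reflexive (trans (∣-∣≡∣⊖∣ a b) (cong ∣_∣ (sym (ℤₚ.m-n≡m⊖n a b))))) ∣a-b∣≤1

roughlyEqual-after-padding : ∀ a b j → 1 ≤ j → + a - + b ≡ + j →
  RoughlyEqual (a ℕ.+ 0) (b ℕ.+ (j ∸ 1))
roughlyEqual-after-padding a b (ℕ.suc i) _ a-b≡j =
  roughlyEqual-from-ℤ (a ℕ.+ 0) (b ℕ.+ i) (ℕₚ.≤-reflexive (cong ∣_∣ (begin
    + (a ℕ.+ 0) - + (b ℕ.+ i)        ≡⟨ cong₂ _-_ (ℤₚ.pos-+ a 0) (ℤₚ.pos-+ b i) ⟩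
    (+ a + + 0) - (+ b + + i)        ≡⟨ regroup (+ a) (+ b) (+ i) ⟩
    (+ a - + b) - + i                ≡⟨ cong (_- + i) a-b≡j ⟩
    (+ 1 + + i) - + i                ≡⟨ cancel (+ i) ⟩
    + 1                              ∎)))
  where
  regroup : ∀ a b i → (a + + 0) - (b + i) ≡ (a - b) - i
  regroup = ℤ-Solver.solve-∀
  cancel : ∀ i → (+ 1 + i) - i ≡ + 1
  cancel = ℤ-Solver.solve-∀

∣δ∣≤2 : ∀ δ → (δ ≡ - (+ 2) ⊎ δ ≡ + 0 ⊎ δ ≡ + 2) → ∣ δ ∣ ≤ 2
∣δ∣≤2 _ (inj₁ refl)        = ℕₚ.≤-refl
∣δ∣≤2 _ (inj₂ (inj₁ refl)) = ℕ.z≤n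
∣δ∣≤2 _ (inj₂ (inj₂ refl)) = ℕₚ.≤-refl

2x≡-δ⇒∣x∣≤1 : ∀ x δ → (δ ≡ - (+ 2) ⊎ δ ≡ + 0 ⊎ δ ≡ + 2) → + 2 * x ≡ - δ → ∣ x ∣ ≤ 1
2x≡-δ⇒∣x∣≤1 x δ δ∈ 2x≡-δ = ℕₚ.*-cancelˡ-≤ 2 (ℕₚ.≤-trans (ℕₚ.≤-reflexive (begin
  2 ℕ.* ∣ x ∣   ≡⟨ sym (ℤₚ.abs-* (+ 2) x) ⟩
  ∣ + 2 * x ∣   ≡⟨ cong ∣_∣ 2x≡-δ ⟩
  ∣ - δ ∣       ≡⟨ ℤₚ.∣-i∣≡∣i∣ δ ⟩
  ∣ δ ∣         ∎)) (∣δ∣≤2 δ δ∈))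

cvd≤-from-balances : ∀ m size (f : Labeling m size) j → 1 ≤ j →
  sum (balance f) ≡ + j → ∣ pairSum (balance f) ∣ ≤ 1 → CvdAtMost m size (j ∸ 1)
cvd≤-from-balances m size f j 1≤j Σbalance≡j ∣e₂∣≤1 =
  f , j ∸ 1 , ℕₚ.≤-refl , edgesBalanced , 0 , j ∸ 1 , refl , verticesBalanced
  where
  edgesBalanced : RoughlyEqual (ecount m size f false) (ecount m size f true)
  edgesBalanced = roughlyEqual-from-ℤ (ecount m size f false) (ecount m size f true)
    (ℕₚ.≤-trans (ℕₚ.≤-reflexive (cong ∣_∣ (ecount-balance m size f))) ∣e₂∣≤1)
  verticesBalanced : RoughlyEqual (vcount m size f false ℕ.+ 0) (vcount m size f true ℕ.+ (j ∸ 1))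
  verticesBalanced =
    roughlyEqual-after-padding (vcount m size f false) (vcount m size f true) j 1≤j
      (trans (vcount-balance m size f) Σbalance≡j)

theorem5 : (m : ℕ) (size : Fin m → ℕ) → (∀ i → 1 ≤ size i) →
    (n j : ℕ) (δ : ℤ) → oddParts m size ≡ n → 1 ≤ n → 1 ≤ j →
    (δ ≡ - (+ 2) ⊎ δ ≡ + 0 ⊎ δ ≡ + 2) →
    + n ≡ (+ j) * (+ j) + δ →
    CvdAtMost m size (j ∸ 1)
theorem5 m size _ n j δ odd≡n _ 1≤j δ∈ n≡j²+δ
  with q , q+j+q≡n ← n≡j²+δ⇒∃[q]q+j+q≡n n j δ δ∈ n≡j²+δ
  with σ , Σ≡p-q ← signs-with-sum m (isOdd ∘ size) (q ℕ.+ j) q (trans q+j+q≡n (sym odd≡n))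
  = cvd≤-from-balances m size f j 1≤j Σd≡j
      (2x≡-δ⇒∣x∣≤1 (pairSum (balance f)) δ δ∈ (2*pairSum≡-δ (balance f) (+ j) (+ n) δ Σd≡j Σd²≡n n≡j²+δ))
  where
  f : Labeling m size
  f = alternating σ
  Σd≡j : sum (balance f) ≡ + j
  Σd≡j = trans (alternating-balance-sum m size σ) (trans Σ≡p-q (+[q+j]-+q≡+j q j))
  Σd²≡n : ∑[ i < m ] (balance f i * balance f i) ≡ + n
  Σd²≡n = trans (alternating-square-sum m size σ) (cong +_ odd≡n)
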